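{- Let $A\in\mathsf{FOR}^\ast$. There exists $\varphi\in\mathsf{FOR}$ such that $\models_{\mathsf{CPL}} A\leftrightarrow St(\varphi)$ if and only if $A$ is $\mathsf{S}$-set invariant.
   Context: Let $\Phi=\{p_0,p_1,p_2,\dots\}$ be a countably infinite set of propositional letters. $\mathsf{FOR}$ is the set of formulas built inductively from $\Phi$ using $\neg$ and the binary connectives $\lor,\wedge,\to,\leftrightarrow,\vartriangle,\looparrowright$. An Epstein model is a pair $\mathfrak{M}=\langle v,\mathfrak{R}\rangle$ with $v:\Phi\to\{0,1\}$ and $\mathfrak{R}\subseteq\mathsf{FOR}\times\mathsf{FOR}$. Truth $\mathfrak{M}\vDash\varphi$: $\mathfrak{M}\vDash p$ iff $v(p)=1$ for $p\in\Phi$; classical clauses for $\neg,\wedge,\lor,\to,\leftrightarrow$; $\mathfrak{M}\vDash\psi\vartriangle\chi$ iff $\mathfrak{M}\vDash\psi$, $\mathfrak{M}\vDash\chi$ and $\langle\psi,\chi\rangle\in\mathfrak{R}$; $\mathfrak{M}\vDash\psi\looparrowright\chi$ iff ($\mathfrak{M}\nvDash\psi$ or $\mathfrak{M}\vDash\chi$) and $\langle\psi,\chi\rangle\in\mathfrak{R}$. For $\mathfrak{M}=\langle v,\mathfrak{R}\rangle$ let $\Omega^{\mathfrak{M}}=\{\langle\varphi,\psi\rangle:\mathfrak{M}\nvDash\varphi\to\psi\}$ and $\mathsf{S}^{\mathfrak{M}}=\{\langle v',\mathfrak{R}'\rangle: v'=v,\ \mathfrak{R}\setminus\Omega^{\mathfrak{M}}\subseteq\mathfrak{R}'\subseteq\mathfrak{R}\cup\Omega^{\mathfrak{M}}\}$.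 Let $\mathsf{At}=\Phi\cup\{p_{\langle\varphi,\psi\rangle}:\varphi,\psi\in\mathsf{FOR}\}$ (new atoms indexed by pairs of formulas), and $\mathsf{FOR}^\ast$ the set of classical propositional formulas over $\mathsf{At}$ with connectives $\neg,\wedge,\lor,\to,\leftrightarrow$. An Epstein model $\mathfrak{M}=\langle v,\mathfrak{R}\rangle$ is regarded as a classical valuation of $\mathsf{FOR}^\ast$: $\mathfrak{M}\models_{\mathsf{CPL}}p_n$ iff $v(p_n)=1$, $\mathfrak{M}\models_{\mathsf{CPL}}p_{\langle\varphi,\psi\rangle}$ iff $\langle\varphi,\psi\rangle\in\mathfrak{R}$, extended classically. $\models_{\mathsf{CPL}}A$ means $\mathfrak{M}\models_{\mathsf{CPL}}A$ for every Epstein model $\mathfrak{M}$. The standard translation $St:\mathsf{FOR}\to\mathsf{FOR}^\ast$: $St(p_n)=p_n$; $St(\neg\varphi)=\neg St(\varphi)$; $St(\varphi\ast\psi)=St(\varphi)\ast St(\psi)$ for $\ast\in\{\lor,\wedge,\to,\leftrightarrow\}$; $St(\varphi\looparrowright\psi)=St(\varphi\to\psi)\wedge p_{\langle\varphi,\psi\rangle}$; $St(\varphi\vartriangle\psi)=St(\varphi\wedge\psi)\wedge p_{\langle\varphi,\psi\rangle}$. A formula $A\in\mathsf{FOR}^\ast$ is $\mathsf{S}$-set invariant iff for all Epstein models $\mathfrak{M},\mathfrak{N}$: if $\mathfrak{M}\models_{\mathsf{CPL}}A$ and $\mathfrak{N}\in\mathsf{S}^{\mathfrak{M}}$ then $\mathfrak{N}\models_{\mathsf{CPL}}A$.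 -}

module Defs where

open import Data.Nat using (ℕ)
open import Data.Bool using (Bool; true; false; not; _∧_; _∨_)
open import Data.Product using (Σ; _×_; _,_)
open import Relation.Binary.PropositionalEquality using (_≡_)
open import Function.Bundles using (_⇔_)

_⇒ᵇ_ : Bool → Bool → Bool
a ⇒ᵇ b = not a ∨ b

_⇔ᵇ_ : Bool → Bool → Bool
true  ⇔ᵇ b = b
false ⇔ᵇ b = not b

data FOR : Set where
  var  : ℕ → FOR
  ¬'_  : FOR → FOR
  _∨'_ _∧'_ _→'_ _↔'_ : FOR → FOR → FOR
  _△_  : FOR → FOR → FOR
  _↬_  : FOR → FOR → FOR

record Model : Set where
  constructor ⟨_,_⟩
  field
    val : ℕ → Bool
    rel : FOR → FOR → Bool
open Model public

⟦_⟧ : FOR → Model → Bool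
⟦ var n ⟧ M = val M n
⟦ ¬' φ ⟧ M = not (⟦ φ ⟧ M)
⟦ φ ∨' ψ ⟧ M = ⟦ φ ⟧ M ∨ ⟦ ψ ⟧ M
⟦ φ ∧' ψ ⟧ M = ⟦ φ ⟧ M ∧ ⟦ ψ ⟧ M
⟦ φ →' ψ ⟧ M = ⟦ φ ⟧ M ⇒ᵇ ⟦ ψ ⟧ M
⟦ φ ↔' ψ ⟧ M = ⟦ φ ⟧ M ⇔ᵇ ⟦ ψ ⟧ M
⟦ φ △ ψ ⟧ M = (⟦ φ ⟧ M ∧ ⟦ ψ ⟧ M) ∧ rel M φ ψ
⟦ φ ↬ ψ ⟧ M = (not (⟦ φ ⟧ M) ∨ ⟦ ψ ⟧ M) ∧ rel M φ ψ

_⊨_ : Model → FOR → Set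
M ⊨ φ = ⟦ φ ⟧ M ≡ true

Ω : Model → FOR → FOR → Bool
Ω M φ ψ = not (⟦ φ →' ψ ⟧ M)

_∈S_ : Model → Model → Set
N ∈S M = (val N ≡ val M)
       × (∀ φ ψ → (rel M φ ψ ∧ not (Ω M φ ψ)) ≡ true → rel N φ ψ ≡ true)
       × (∀ φ ψ → rel N φ ψ ≡ true → (rel M φ ψ ∨ Ω M φ ψ) ≡ true)

data At : Set where
  atom : ℕ → At
  pair : FOR → FOR → At

data FOR* : Set where
  at   : At → FOR*
  ¬*_  : FOR* → FOR*
  _∨*_ _∧*_ _→*_ _↔*_ : FOR* → FOR* → FOR*

⟦_⟧* : FOR* → Model → Bool
⟦ at (atom n) ⟧* M = val M n
⟦ at (pair φ ψ) ⟧* M = rel M φ ψ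
⟦ ¬* A ⟧* M = not (⟦ A ⟧* M)
⟦ A ∨* B ⟧* M = ⟦ A ⟧* M ∨ ⟦ B ⟧* M
⟦ A ∧* B ⟧* M = ⟦ A ⟧* M ∧ ⟦ B ⟧* M
⟦ A →* B ⟧* M = ⟦ A ⟧* M ⇒ᵇ ⟦ B ⟧* M
⟦ A ↔* B ⟧* M = ⟦ A ⟧* M ⇔ᵇ ⟦ B ⟧* M

_⊨CPL_ : Model → FOR* → Set
M ⊨CPL A = ⟦ A ⟧* M ≡ true

Valid : FOR* → Set
Valid A = ∀ M → M ⊨CPL A

St : FOR → FOR*
St (var n) = at (atom n)
St (¬' φ) = ¬* St φ
St (φ ∨' ψ) = St φ ∨* St ψ
St (φ ∧' ψ) = St φ ∧* St ψ
St (φ →' ψ) = St φ →* St ψ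
St (φ ↔' ψ) = St φ ↔* St ψ
St (φ ↬ ψ) = (St φ →* St ψ) ∧* at (pair φ ψ)
St (φ △ ψ) = (St φ ∧* St ψ) ∧* at (pair φ ψ)

SInvariant : FOR* → Set
SInvariant A = ∀ M N → M ⊨CPL A → N ∈S M → N ⊨CPL A

-- A formula of FOR only consults ⟨φ , ψ⟩ ∈ R when M ⊨ φ → ψ, and on such pairs every
-- member of S^M has the same relation as M; hence St φ is S-set invariant. Conversely, let
-- prune M be M with Ω^M removed from its relation. M and prune M lie in each other's S-sets,
-- so an S-set invariant A takes the same value in both; and in prune M the atom p⟨φ,ψ⟩ has
-- the truth value of St (φ ↬ ψ) in M, so replacing each p⟨φ,ψ⟩ in A by φ ↬ ψ yields the φ.
module Submission where

open import Defs
open import Data.Bool using (true; false; not; _∧_; _∨_)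
open import Data.Bool.Properties using (∧-comm; ∧-identityʳ; ∨-identityʳ; ∨-inverseʳ; not-involutive)
open import Data.Product using (Σ; _,_)
open import Function.Bundles using (_⇔_; mk⇔; Equivalence)
open import Relation.Binary.PropositionalEquality
  using (_≡_; refl; sym; trans; cong; cong₂; subst)

private
  variable
    M N : Model
    φ ψ : FOR

true⇔⇒≡ : ∀ a b → (a ≡ true → b ≡ true) → (b ≡ true → a ≡ true) → a ≡ b
true⇔⇒≡ true  b     a⇒b _   = sym (a⇒b refl)
true⇔⇒≡ false true  _   b⇒a = b⇒a refl
true⇔⇒≡ false false _   _   = refl

⇔ᵇ≡true⇔≡ : ∀ a b → (a ⇔ᵇ b) ≡ true ⇔ a ≡ b
⇔ᵇ≡true⇔≡ a b = mk⇔ (to a b) (λ { refl → from a })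
  where
  to : ∀ a b → (a ⇔ᵇ b) ≡ true → a ≡ b
  to true  true  _ = refl
  to false false _ = refl
  from : ∀ a → (a ⇔ᵇ a) ≡ true
  from true  = refl
  from false = refl

∧≡true⇒ˡ : ∀ a {b} → a ∧ b ≡ true → a ≡ true
∧≡true⇒ˡ true _ = refl

∧≡true⇒⇒ᵇ≡true : ∀ a b → a ∧ b ≡ true → (a ⇒ᵇ b) ≡ true
∧≡true⇒⇒ᵇ≡true true true _ = refl

∧-congˡ-if-true : ∀ c {r r′} → (c ≡ true → r ≡ r′) → c ∧ r ≡ c ∧ r′
∧-congˡ-if-true true  r≡r′ = r≡r′ refl
∧-congˡ-if-true false _    = refl

Valid-↔*⇔ : ∀ A B → Valid (A ↔* B) ⇔ (∀ M → ⟦ A ⟧* M ≡ ⟦ B ⟧* M)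
Valid-↔*⇔ A B = mk⇔
  (λ valid M → Equivalence.to (⇔ᵇ≡true⇔≡ (⟦ A ⟧* M) (⟦ B ⟧* M)) (valid M))
  (λ same M → Equivalence.from (⇔ᵇ≡true⇔≡ (⟦ A ⟧* M) (⟦ B ⟧* M)) (same M))

⟦St⟧≡⟦⟧ : ∀ φ M → ⟦ St φ ⟧* M ≡ ⟦ φ ⟧ M
⟦St⟧≡⟦⟧ (var n)  M = refl
⟦St⟧≡⟦⟧ (¬' φ)   M = cong not (⟦St⟧≡⟦⟧ φ M)
⟦St⟧≡⟦⟧ (φ ∨' ψ) M = cong₂ _∨_ (⟦St⟧≡⟦⟧ φ M) (⟦St⟧≡⟦⟧ ψ M)
⟦St⟧≡⟦⟧ (φ ∧' ψ) M = cong₂ _∧_ (⟦St⟧≡⟦⟧ φ M) (⟦St⟧≡⟦⟧ ψ M)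
⟦St⟧≡⟦⟧ (φ →' ψ) M = cong₂ _⇒ᵇ_ (⟦St⟧≡⟦⟧ φ M) (⟦St⟧≡⟦⟧ ψ M)
⟦St⟧≡⟦⟧ (φ ↔' ψ) M = cong₂ _⇔ᵇ_ (⟦St⟧≡⟦⟧ φ M) (⟦St⟧≡⟦⟧ ψ M)
⟦St⟧≡⟦⟧ (φ △ ψ)  M = cong₂ (λ a b → (a ∧ b) ∧ rel M φ ψ) (⟦St⟧≡⟦⟧ φ M) (⟦St⟧≡⟦⟧ ψ M)
⟦St⟧≡⟦⟧ (φ ↬ ψ)  M = cong₂ (λ a b → (not a ∨ b) ∧ rel M φ ψ) (⟦St⟧≡⟦⟧ φ M) (⟦St⟧≡⟦⟧ ψ M)

∈S-rel-agrees : N ∈S M → M ⊨ (φ →' ψ) → rel N φ ψ ≡ rel M φ ψ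
∈S-rel-agrees {N} {M} {φ} {ψ} (_ , keeps , bounded) holds =
  true⇔⇒≡ (rel N φ ψ) (rel M φ ψ)
    (λ inN → trans (sym rel∨Ω≡rel) (bounded φ ψ inN))
    (λ inM → keeps φ ψ (trans rel∧¬Ω≡rel inM))
  where
  rel∨Ω≡rel : rel M φ ψ ∨ Ω M φ ψ ≡ rel M φ ψ
  rel∨Ω≡rel = trans (cong (λ c → rel M φ ψ ∨ not c) holds) (∨-identityʳ (rel M φ ψ))
  rel∧¬Ω≡rel : rel M φ ψ ∧ not (Ω M φ ψ) ≡ rel M φ ψ
  rel∧¬Ω≡rel = trans (cong (λ c → rel M φ ψ ∧ not (not c)) holds) (∧-identityʳ (rel M φ ψ))

∈S-preserves-⟦⟧ : N ∈S M → ∀ φ → ⟦ φ ⟧ N ≡ ⟦ φ ⟧ M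
∈S-preserves-⟦⟧ (same-val , _) (var n) = cong (λ v → v n) same-val
∈S-preserves-⟦⟧ s (¬' φ)   = cong not (∈S-preserves-⟦⟧ s φ)
∈S-preserves-⟦⟧ s (φ ∨' ψ) = cong₂ _∨_ (∈S-preserves-⟦⟧ s φ) (∈S-preserves-⟦⟧ s ψ)
∈S-preserves-⟦⟧ s (φ ∧' ψ) = cong₂ _∧_ (∈S-preserves-⟦⟧ s φ) (∈S-preserves-⟦⟧ s ψ)
∈S-preserves-⟦⟧ s (φ →' ψ) = cong₂ _⇒ᵇ_ (∈S-preserves-⟦⟧ s φ) (∈S-preserves-⟦⟧ s ψ)
∈S-preserves-⟦⟧ s (φ ↔' ψ) = cong₂ _⇔ᵇ_ (∈S-preserves-⟦⟧ s φ) (∈S-preserves-⟦⟧ s ψ)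
∈S-preserves-⟦⟧ {N} {M} s (φ △ ψ) =
  trans (cong₂ (λ a b → (a ∧ b) ∧ rel N φ ψ) (∈S-preserves-⟦⟧ s φ) (∈S-preserves-⟦⟧ s ψ))
        (∧-congˡ-if-true (⟦ φ ⟧ M ∧ ⟦ ψ ⟧ M)
          (λ both → ∈S-rel-agrees s (∧≡true⇒⇒ᵇ≡true (⟦ φ ⟧ M) (⟦ ψ ⟧ M) both)))
∈S-preserves-⟦⟧ {N} {M} s (φ ↬ ψ) =
  trans (cong₂ (λ a b → (not a ∨ b) ∧ rel N φ ψ) (∈S-preserves-⟦⟧ s φ) (∈S-preserves-⟦⟧ s ψ))
        (∧-congˡ-if-true (⟦ φ →' ψ ⟧ M) (∈S-rel-agrees s))

St-SInvariant : ∀ φ → SInvariant (St φ)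
St-SInvariant φ M N M⊨ N∈S =
  trans (⟦St⟧≡⟦⟧ φ N) (trans (∈S-preserves-⟦⟧ N∈S φ) (trans (sym (⟦St⟧≡⟦⟧ φ M)) M⊨))

SInvariant-resp-equiv : ∀ A B → (∀ M → ⟦ A ⟧* M ≡ ⟦ B ⟧* M) → SInvariant B → SInvariant A
SInvariant-resp-equiv A B same inv M N M⊨A N∈S =
  trans (same N) (inv M N (trans (sym (same M)) M⊨A) N∈S)

prune : Model → Model
prune M = ⟨ val M , (λ φ ψ → rel M φ ψ ∧ ⟦ φ →' ψ ⟧ M) ⟩

prune-∈S : ∀ M → prune M ∈S M
prune-∈S M = refl , keeps , bounded
  where
  keeps : ∀ φ ψ → (rel M φ ψ ∧ not (Ω M φ ψ)) ≡ true → (rel M φ ψ ∧ ⟦ φ →' ψ ⟧ M) ≡ true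
  keeps φ ψ = subst (λ c → (rel M φ ψ ∧ c) ≡ true) (not-involutive (⟦ φ →' ψ ⟧ M))
  bounded : ∀ φ ψ → (rel M φ ψ ∧ ⟦ φ →' ψ ⟧ M) ≡ true → (rel M φ ψ ∨ Ω M φ ψ) ≡ true
  bounded φ ψ inR rewrite ∧≡true⇒ˡ (rel M φ ψ) inR = refl

∈S-prune : ∀ M → M ∈S prune M
∈S-prune M = refl , keeps , bounded
  where
  keeps : ∀ φ ψ → ((rel M φ ψ ∧ ⟦ φ →' ψ ⟧ M) ∧ not (Ω (prune M) φ ψ)) ≡ true → rel M φ ψ ≡ true
  keeps φ ψ inR = ∧≡true⇒ˡ (rel M φ ψ) (∧≡true⇒ˡ (rel M φ ψ ∧ ⟦ φ →' ψ ⟧ M) inR)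
  bounded : ∀ φ ψ → rel M φ ψ ≡ true → ((rel M φ ψ ∧ ⟦ φ →' ψ ⟧ M) ∨ Ω (prune M) φ ψ) ≡ true
  bounded φ ψ inR
    rewrite ∈S-preserves-⟦⟧ (prune-∈S M) (φ →' ψ) | inR = ∨-inverseʳ (⟦ φ →' ψ ⟧ M)

SInvariant⇒prune-stable : ∀ A → SInvariant A → ∀ M → ⟦ A ⟧* (prune M) ≡ ⟦ A ⟧* M
SInvariant⇒prune-stable A inv M =
  true⇔⇒≡ (⟦ A ⟧* (prune M)) (⟦ A ⟧* M)
    (λ pruned⊨A → inv (prune M) M pruned⊨A (∈S-prune M))
    (λ M⊨A → inv M (prune M) M⊨A (prune-∈S M))

unSt : FOR* → FOR
unSt (at (atom n))   = var n
unSt (at (pair φ ψ)) = φ ↬ ψ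
unSt (¬* A)          = ¬' unSt A
unSt (A ∨* B)        = unSt A ∨' unSt B
unSt (A ∧* B)        = unSt A ∧' unSt B
unSt (A →* B)        = unSt A →' unSt B
unSt (A ↔* B)        = unSt A ↔' unSt B

⟦St∘unSt⟧≡⟦⟧*∘prune : ∀ A M → ⟦ St (unSt A) ⟧* M ≡ ⟦ A ⟧* (prune M)
⟦St∘unSt⟧≡⟦⟧*∘prune (at (atom n))   M = refl
⟦St∘unSt⟧≡⟦⟧*∘prune (at (pair φ ψ)) M =
  trans (cong (_∧ rel M φ ψ) (⟦St⟧≡⟦⟧ (φ →' ψ) M)) (∧-comm (⟦ φ →' ψ ⟧ M) (rel M φ ψ))
⟦St∘unSt⟧≡⟦⟧*∘prune (¬* A)   M = cong not (⟦St∘unSt⟧≡⟦⟧*∘prune A M)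
⟦St∘unSt⟧≡⟦⟧*∘prune (A ∨* B) M = cong₂ _∨_ (⟦St∘unSt⟧≡⟦⟧*∘prune A M) (⟦St∘unSt⟧≡⟦⟧*∘prune B M)
⟦St∘unSt⟧≡⟦⟧*∘prune (A ∧* B) M = cong₂ _∧_ (⟦St∘unSt⟧≡⟦⟧*∘prune A M) (⟦St∘unSt⟧≡⟦⟧*∘prune B M)
⟦St∘unSt⟧≡⟦⟧*∘prune (A →* B) M = cong₂ _⇒ᵇ_ (⟦St∘unSt⟧≡⟦⟧*∘prune A M) (⟦St∘unSt⟧≡⟦⟧*∘prune B M)
⟦St∘unSt⟧≡⟦⟧*∘prune (A ↔* B) M = cong₂ _⇔ᵇ_ (⟦St∘unSt⟧≡⟦⟧*∘prune A M) (⟦St∘unSt⟧≡⟦⟧*∘prune B M)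

mainTheorem2 : (A : FOR*) → (Σ FOR (λ φ → Valid (A ↔* St φ))) ⇔ SInvariant A
mainTheorem2 A = mk⇔ translatable⇒invariant invariant⇒translatable
  where
  translatable⇒invariant : Σ FOR (λ φ → Valid (A ↔* St φ)) → SInvariant A
  translatable⇒invariant (φ , valid) =
    SInvariant-resp-equiv A (St φ) (Equivalence.to (Valid-↔*⇔ A (St φ)) valid) (St-SInvariant φ)
  invariant⇒translatable : SInvariant A → Σ FOR (λ φ → Valid (A ↔* St φ))
  invariant⇒translatable inv = unSt A , Equivalence.from (Valid-↔*⇔ A (St (unSt A))) λ M →
    trans (sym (SInvariant⇒prune-stable A inv M)) (sym (⟦St∘unSt⟧≡⟦⟧*∘prune A M))
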